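{- Let $t\ge 2$, $n\ge 1$, and let $v_1,v_2$ be $t$-th roots of $M^t(K_n)$, different from $u_t$, such that there is a directed path from $v_1$ to $v_2$ in $F^{\circ}_t$. Then $N(\{v_2,h^{ -1}(v_2)\})\cap T(V(K_n))\subseteq N(\{v_1,h^{ -1}(v_1)\})$ and $N(v_2)\cap T(V(K_n))\subseteq N(v_1)$.
   Context: The Mycielski graph $M(G)$ of a simple graph $G$ with $V(G)=\{x_1,\dots,x_n\}$ has vertex set $\{x_1,\dots,x_n\}\cup\{x_1',\dots,x_n'\}\cup\{u\}$ and edge set $E(G)\cup\{x_i'x_j:x_ix_j\in E(G)\}\cup\{ux_i'\}$; $x_i'$ is the twin of $x_i$ and $u$ the root. $M^0(G)=G$, $M^t(G)=M(M^{t-1}(G))$, with $M^i(G)$ regarded as a subgraph of $M^j(G)$ for $i\le j$. Naming: for a vertex $y$ of $M^s(G)$ and $j\ge1$, $y^j$ is the twin of $y$ (regarded as a vertex of $M^{s+j-1}(G)$) in $M^{s+j}(G)$, and $y^{j_1\cdots j_n}=(y^{j_1\cdots j_{n-1}})^{j_n}$. For $1\le i\le t$, $u_i$ is the root added when forming $M^i(G)$ from $M^{i-1}(G)$. The vertices of $G$ are initial vertices; $T(V(G))$ is the set of all $x^{i_1\cdots i_n}$ with $x\in V(G)$, $n\ge1$, $i_l\ge 1$, $i_1+\cdots+i_n\le t$. The $s$-th roots of $M^t(G)$ ($s\le t$) are the vertices $u_i^{i_1\cdots i_n}$ ($n\ge 0$, $i_l\ge 1$) with $i+i_1+\cdots+i_n=s$;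 their set is $R_s(M^t(G))$, and $R(M^t(G))=\bigcup_{s\le t}R_s(M^t(G))$. The bijection $h:R(M^{t-1}(G))\to R_t(M^t(G))\setminus\{u_t\}$ sends $w$ to its twin in $M^t(G)=M(M^{t-1}(G))$, i.e. $h(u_i^{i_1\cdots i_{n-1}})=u_i^{i_1\cdots i_{n-1}i_n}$ with $i+i_1+\cdots+i_n=t$. $F^{\circ}_t$ is the digraph on $R_t(M^t(G))\setminus\{u_t\}$ with arcs $(u_i^{i_1\cdots i_{n-1}i_n},u_i^{i_1\cdots i_{n-1}\,j\,(i_n-j)})$ for $1\le i\le t-1$, $i+i_1+\cdots+i_n=t$, $i_n\ge2$, $1\le j\le i_n-1$. For a set $A$ of vertices, $N(A)$ is the union of the neighborhoods (in $M^t(K_n)$) of the vertices of $A$; $N(v)$ is the neighborhood of $v$. -}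

module Defs where

open import Data.Nat using (ℕ; zero; suc; _+_)
open import Data.Fin using (Fin)
open import Data.List using (List; []; _∷_; _∷ʳ_; _++_)
open import Data.Product using (Σ; _×_)
open import Data.Empty using (⊥)
open import Data.Unit using (⊤)
open import Relation.Nullary using (¬_)
open import Relation.Binary.PropositionalEquality using (_≡_)
open import Relation.Unary using (Pred)

-- Vertices of the iterated Mycielski graph M^t(K_n).
--   init i : initial vertex x_i of K_n            (level 0)
--   old  v : v ∈ V(M^t) regarded as a vertex of M^{t+1}
--   tw   v : the twin v' of v ∈ V(M^t) in M^{t+1} = M(M^t)
--   root   : the root u_{t+1} added when forming M^{t+1}
data V (n : ℕ) : ℕ → Set where
  init : Fin n → V n 0
  old  : {t : ℕ} → V n t → V n (suc t)
  tw   : {t : ℕ} → V n t → V n (suc t)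
  root : {t : ℕ} → V n (suc t)

Adj : {n t : ℕ} → V n t → V n t → Set
Adj (init i) (init j) = ¬ (i ≡ j)
Adj (old x) (old y) = Adj x y
Adj (old x) (tw y) = Adj x y
Adj (tw x) (old y) = Adj x y
Adj (tw x) root = ⊤
Adj root (tw y) = ⊤
Adj _ _ = ⊥

N : {n t : ℕ} → V n t → Pred (V n t) _
N v = Adj v

-- Regarded w v : v is the vertex w of M^s(K_n) regarded as a vertex of
-- M^t(K_n) (s ≤ t) via the inclusions M^s ⊆ M^{s+1} ⊆ … ⊆ M^t.
data Regarded {n : ℕ} {s : ℕ} (w : V n s) : {t : ℕ} → V n t → Set where
  here  : Regarded w w
  there : {t : ℕ} {v : V n t} → Regarded w v → Regarded w (old v)

emb : {n s : ℕ} (k : ℕ) → V n s → V n (k + s)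
emb zero y = y
emb (suc k) y = old (emb k y)

-- pow j y = y^{j+1}: the twin of y (regarded in M^{s+j}) in M^{s+j+1}.
-- (Exponents are positive; we store the predecessor j of the exponent j+1.)
pow : {n s : ℕ} (j : ℕ) → V n s → V n (suc j + s)
pow j y = tw (emb j y)

lvl : List ℕ → ℕ → ℕ
lvl [] s = s
lvl (j ∷ js) s = lvl js (suc j + s)

-- pows (j₁ ∷ … ∷ jₘ) y = y^{(j₁+1)⋯(jₘ+1)} = (y^{(j₁+1)⋯(j_{m-1}+1)})^{jₘ+1}
pows : {n s : ℕ} (js : List ℕ) → V n s → V n (lvl js s)
pows [] y = y
pows (j ∷ js) y = pows js (pow j y)

-- u_{i+1} = root {i}, a vertex of M^{i+1}.
-- v ∈ R_s(M^t(K_n)): v = u_{i+1}^{js} (regarded in M^t) with (i+1) + Σ exponents = s.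
InRs : {n t : ℕ} → ℕ → V n t → Set
InRs {n} s v = Σ ℕ λ i → Σ (List ℕ) λ js →
  (lvl js (suc i) ≡ s) × Regarded (pows {n} js (root {n} {i})) v

-- v ∈ R(M^t(K_n)) = ⋃_{s ≤ t} R_s(M^t(K_n))   (s ≤ t is automatic).
InR : {n t : ℕ} → V n t → Set
InR v = Σ ℕ λ s → InRs s v

-- v ∈ T(V(K_n)): v = x^{i₁⋯iₘ} (m ≥ 1, regarded in M^t), x initial.
InT : {n t : ℕ} → V n t → Set
InT {n} v = Σ (Fin n) λ x → Σ ℕ λ j → Σ (List ℕ) λ js →
  Regarded (pows (j ∷ js) (init x)) v

-- Arcs of F°_t (t = the level of v, v'):
--   ( u_{i+1}^{js · (a+b+2)} , u_{i+1}^{js · (a+1) · (b+1)} ),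
-- i.e. last exponent iₙ = a+b+2 ≥ 2 and j = a+1 ∈ [1, iₙ-1], iₙ - j = b+1;
-- (i+1) + Σ exponents = t.  (i+1 ≤ t-1 holds automatically.)
Arc : {n t : ℕ} → V n t → V n t → Set
Arc {n} {t} v v' = Σ ℕ λ i → Σ (List ℕ) λ js → Σ ℕ λ a → Σ ℕ λ b →
  (lvl (js ∷ʳ (a + suc b)) (suc i) ≡ t)
  × Regarded (pows {n} (js ∷ʳ (a + suc b)) (root {n} {i})) v
  × Regarded (pows {n} (js ++ (a ∷ b ∷ [])) (root {n} {i})) v'

module Submission where

open import Defs
open import Data.Nat using (ℕ; zero; suc; _≤_; _+_)
open import Data.Nat.Properties using (≤-refl; m≤n⇒m≤1+n; 1+n≰n; suc-injective)
open import Data.Nat.Tactic.RingSolver using (solve-∀)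
open import Data.Product using (Σ; _×_; _,_)
open import Data.Sum using (inj₁; inj₂)
open import Data.Unit using (tt)
open import Data.Empty using (⊥-elim)
open import Data.List using (List; []; _∷_; _∷ʳ_; _++_)
open import Relation.Nullary using (¬_)
open import Relation.Binary.PropositionalEquality using (_≡_; refl; trans; cong; subst)
open import Relation.Unary using (_⊆_; _∩_; _∪_)
open import Relation.Binary.Construct.Closure.ReflexiveTransitive using (Star; ε; _◅_; map)

-- The heads of the arcs of F°_t arise from the tails by replacing one twin step "tw" by an
-- inclusion "old" (u^{…(a+1)(b+1)} versus u^{…(a+b+2)}).  Since the twin x' of x has, outside
-- the root, only the neighbours of x that are old vertices, such a replacement can only enlarge
-- the root-free part of a neighbourhood, and the root-free vertices include all of T(V(K_n)).
-- Along a path of F°_t these inclusions compose.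

data RootFree {n : ℕ} : {t : ℕ} → V n t → Set where
  init : (i : _) → RootFree (init i)
  old  : {t : ℕ} {y : V n t} → RootFree y → RootFree (old y)
  tw   : {t : ℕ} {y : V n t} → RootFree y → RootFree (tw y)

InT⊆RootFree : {n t : ℕ} → InT {n} {t} ⊆ RootFree
InT⊆RootFree (x , j , js , r) = regarded (pows-rootFree (j ∷ js) (init x)) r
  where
  emb-rootFree : {n s : ℕ} (k : ℕ) {y : V n s} → RootFree y → RootFree (emb k y)
  emb-rootFree zero p = p
  emb-rootFree (suc k) p = old (emb-rootFree k p)

  pows-rootFree : {n s : ℕ} (js : List ℕ) {y : V n s} → RootFree y → RootFree (pows js y)
  pows-rootFree [] p = p
  pows-rootFree (j ∷ js) p = pows-rootFree js (tw (emb-rootFree j p))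

  regarded : {n s t : ℕ} {w : V n s} {v : V n t} → RootFree w → Regarded w v → RootFree v
  regarded p here = p
  regarded p (there r) = old (regarded p r)

infix 4 _≼_

_≼_ : {n t : ℕ} → V n t → V n t → Set
x ≼ y = RootFree ∩ N x ⊆ N y

≼-refl : {n t : ℕ} {x : V n t} → x ≼ x
≼-refl (_ , a) = a

≼-trans : {n t : ℕ} {x y z : V n t} → x ≼ y → y ≼ z → x ≼ z
≼-trans x≼y y≼z (p , a) = y≼z (p , x≼y (p , a))

tw≼old : {n t : ℕ} (x : V n t) → tw x ≼ old x
tw≼old x {old y} (_ , a) = a

old-mono-≼ : {n t : ℕ} {x y : V n t} → x ≼ y → old x ≼ old y
old-mono-≼ x≼y {old z} (old p , a) = x≼y (p , a)
old-mono-≼ x≼y {tw z} (tw p , a) = x≼y (p , a)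

tw-mono-≼ : {n t : ℕ} {x y : V n t} → x ≼ y → tw x ≼ tw y
tw-mono-≼ x≼y {old z} (old p , a) = x≼y (p , a)
tw-mono-≼ x≼y {root} (_ , a) = tt

regarded-level≤ : {n s t : ℕ} {w : V n s} {v : V n t} → Regarded w v → s ≤ t
regarded-level≤ here = ≤-refl
regarded-level≤ (there r) = m≤n⇒m≤1+n (regarded-level≤ r)

regarded-trans : {n r s t : ℕ} {u : V n r} {w : V n s} {v : V n t} →
  Regarded u w → Regarded w v → Regarded u v
regarded-trans r here = r
regarded-trans r (there r') = there (regarded-trans r r')

regarded-emb : {n s : ℕ} (k : ℕ) (y : V n s) → Regarded y (emb k y)
regarded-emb zero y = here
regarded-emb (suc k) y = there (regarded-emb k y)

regarded-unique : {n s t : ℕ} {w : V n s} {v v' : V n t} → Regarded w v → Regarded w v' → v ≡ v'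
regarded-unique here here = refl
regarded-unique here (there r) = ⊥-elim (1+n≰n (regarded-level≤ r))
regarded-unique (there r) here = ⊥-elim (1+n≰n (regarded-level≤ r))
regarded-unique (there r) (there r') = cong old (regarded-unique r r')

regarded-twin : {n s t : ℕ} {x : V n s} {v : V n (suc t)} → Regarded (tw x) v → s ≡ t →
  Σ (V n t) λ W → (tw W ≡ v) × Regarded x W
regarded-twin here _ = _ , refl , here
regarded-twin (there r) refl = ⊥-elim (1+n≰n (regarded-level≤ r))

_↑_ : {n s t : ℕ} {x : V n s} {v : V n t} → V n s → Regarded x v → V n t
x' ↑ here = x'
x' ↑ there r = old (x' ↑ r)

regarded-↑ : {n s t : ℕ} {x : V n s} {v : V n t} (x' : V n s) (r : Regarded x v) → Regarded x' (x' ↑ r)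
regarded-↑ x' here = here
regarded-↑ x' (there r) = there (regarded-↑ x' r)

≼-↑ : {n s t : ℕ} {x x' : V n s} {v : V n t} → x ≼ x' → (r : Regarded x v) → v ≼ x' ↑ r
≼-↑ x≼x' here = x≼x'
≼-↑ x≼x' (there r) = old-mono-≼ (≼-↑ x≼x' r)

data TwinStep {n t : ℕ} : V n (suc t) → V n (suc t) → Set where
  twinStep : {W W' : V n t} → W' ≼ W → TwinStep (tw W) (tw W')

twinStep-split : {n L t : ℕ} (y : V n L) (a b c : ℕ) {v v' : V n (suc t)} →
  c + L ≡ t → b + suc (a + L) ≡ t →
  Regarded (tw (emb c y)) v → Regarded (tw (emb b (tw (emb a y)))) v' → TwinStep v v'
twinStep-split {n} y a b c eq eq' r r'
  with regarded-twin r eq | regarded-twin r' eq'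
... | W , refl , rW | W' , refl , rW' = twinStep W'≼W
  where
  z : V n _
  z = emb a y

  rW'-from-tw : Regarded (tw z) W'
  rW'-from-tw = regarded-trans (regarded-emb b (tw z)) rW'

  -- Replacing tw z by old z turns W' into y regarded at the level of W, i.e. into W itself.
  W'≼W : W' ≼ W
  W'≼W = subst (W' ≼_)
    (regarded-unique (regarded-trans (regarded-emb (suc a) y) (regarded-↑ (old z) rW'-from-tw))
                     (regarded-trans (regarded-emb c y) rW))
    (≼-↑ (tw≼old z) rW'-from-tw)

+-suc-interchange : ∀ a b L → b + suc (a + L) ≡ a + suc b + L
+-suc-interchange = solve-∀

arc⇒twinStep : {n t : ℕ} {v v' : V n (suc t)} → Arc v v' → TwinStep v v'
arc⇒twinStep (_ , js , a , b , eq , r , r') = go js root eq r r'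
  where
  go : {n L t : ℕ} {v v' : V n (suc t)} (js : List ℕ) (y : V n L) → lvl (js ∷ʳ (a + suc b)) L ≡ suc t →
    Regarded (pows (js ∷ʳ (a + suc b)) y) v → Regarded (pows (js ++ a ∷ b ∷ []) y) v' → TwinStep v v'
  go {L = L} [] y eq r r' = twinStep-split y a b (a + suc b)
    (suc-injective eq) (trans (+-suc-interchange a b L) (suc-injective eq)) r r'
  go (j ∷ js) y eq r r' = go js (pow j y) eq r r'

star-twinStep⇒≼ : {n t : ℕ} {w₁ w₂ : V n t} → Star TwinStep (tw w₁) (tw w₂) → w₂ ≼ w₁
star-twinStep⇒≼ {w₁ = w₁} ε = ≼-refl {x = w₁}
star-twinStep⇒≼ {w₁ = w₁} {w₂} (twinStep {W' = W'} d ◅ rest) =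
  ≼-trans {x = w₂} {W'} {w₁} (star-twinStep⇒≼ rest) d

lemma8 : (n s : ℕ) → 1 ≤ n → 2 ≤ suc s →
    (v₁ v₂ : V n (suc s)) →
    InRs (suc s) v₁ → ¬ (v₁ ≡ root) →
    InRs (suc s) v₂ → ¬ (v₂ ≡ root) →
    Star Arc v₁ v₂ →
    (w₁ w₂ : V n s) → InR w₁ → InR w₂ → tw w₁ ≡ v₁ → tw w₂ ≡ v₂ →
    (((N v₂ ∪ N (old w₂)) ∩ InT) ⊆ (N v₁ ∪ N (old w₁)))
    × ((N v₂ ∩ InT) ⊆ N v₁)
lemma8 n s _ _ _ _ _ _ _ _ path w₁ w₂ _ _ refl refl = pair-case , twin-case
  where
  w₂≼w₁ : w₂ ≼ w₁
  w₂≼w₁ = star-twinStep⇒≼ (map arc⇒twinStep path)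

  twin-case : (N (tw w₂) ∩ InT) ⊆ N (tw w₁)
  twin-case (a , x∈T) = tw-mono-≼ w₂≼w₁ (InT⊆RootFree x∈T , a)

  pair-case : ((N (tw w₂) ∪ N (old w₂)) ∩ InT) ⊆ (N (tw w₁) ∪ N (old w₁))
  pair-case (inj₁ a , x∈T) = inj₁ (twin-case (a , x∈T))
  pair-case (inj₂ a , x∈T) = inj₂ (old-mono-≼ w₂≼w₁ (InT⊆RootFree x∈T , a))
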